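{- Let $(p_1,\ldots,p_{n-1})$ be an admissible $(n-1)$-tuple and suppose $p_i=2$ for some $1\le i\le n-1$. Then in the group $\Gamma(p_1,\ldots,p_{n-1})=\langle x_0,\ldots,x_{n-1}\rangle$, the subgroup $\langle x_0,\ldots,x_i\rangle$ is isomorphic to $\Gamma(p_1,\ldots,p_i)$ and the subgroup $\langle x_{i-1},\ldots,x_{n-1}\rangle$ is isomorphic to $\Gamma(p_i,\ldots,p_{n-1})$.
   Context: An $(m-1)$-tuple $(p_1,\ldots,p_{m-1})$ of integers $\ge 2$ is admissible if whenever $p_j$ is odd, each of $p_{j-1}$ and $p_{j+1}$ (when its index lies in $\{1,\ldots,m-1\}$) is an even divisor of $2p_j$. For such a tuple, $\Gamma(p_1,\ldots,p_{m-1})$ is the group generated by $m$ involutions (indexed $0,\ldots,m-1$; for a tuple $(p_i,\ldots,p_{n-1})$ one may index them $x_{i-1},\ldots,x_{n-1}$) subject to $x_j^2=1$, $(x_{j-1}x_j)^{p_j}=1$, $(x_jx_k)^2=1$ for $|j-k|\ge 2$, and $r_j=1$ for each $j$ such that $p_j$ and $p_{j+1}$ are both entries of the tuple, where $r_j=(x_{j-1}x_jx_{j+1}x_j)^2$ if $p_j,p_{j+1}$ are both even, $r_j=(x_{j-1}x_jx_{j+1}x_jx_{j+1})^2$ if $p_j$ is odd and $p_{j+1}$ even, and $r_j=(x_{j+1}x_jx_{j-1}x_jx_{j-1})^2$ if $p_j$ is even and $p_{j+1}$ odd. -}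

module Defs where

open import Data.Nat using (ℕ; zero; suc; _+_; _*_; _∸_; _≤_; ∣_-_∣)
open import Data.Nat.Divisibility using (_∣_)
open import Data.Fin using (Fin; toℕ)
open import Data.List using (List; []; _∷_; _++_; length; take; drop)
open import Data.List.Relation.Unary.All using (All)
open import Data.List.Relation.Unary.All.Properties using (++⁺)
open import Data.Maybe using (Maybe; just; nothing)
open import Data.Product using (Σ; _,_; proj₁)
open import Relation.Nullary using (¬_)
open import Relation.Binary.PropositionalEquality using (_≡_)

-- A tuple (p_1,…,p_k) is a list of length k; entry ps j = p_j (1-indexed),
-- and nothing if j is out of range {1,…,k}.
entry : List ℕ → ℕ → Maybe ℕ
entry ps zero = nothing
entry [] (suc j) = nothing
entry (p ∷ ps) (suc zero) = just p
entry (p ∷ ps) (suc (suc j)) = entry ps (suc j)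

-- Admissibility: all entries ≥ 2, and whenever p_j is odd, each neighbour
-- p_{j-1}, p_{j+1} that exists is an even divisor of 2 p_j.
record Admissible (ps : List ℕ) : Set where
  field
    atLeast2 : All (2 ≤_) ps
    leftNb  : ∀ i a b → entry ps (suc i) ≡ just a → ¬ (2 ∣ a) →
              entry ps i ≡ just b → (2 ∣ b) Data.Product.× (b ∣ 2 * a)
    rightNb : ∀ i a b → entry ps (suc i) ≡ just a → ¬ (2 ∣ a) →
              entry ps (suc (suc i)) ≡ just b → (2 ∣ b) Data.Product.× (b ∣ 2 * a)

pow : {A : Set} → List A → ℕ → List A
pow w zero = []
pow w (suc q) = w ++ pow w q

-- Defining relators of Γ(ps), as words in generator indices 0,…,length ps.
-- For generator index j ≥ 1 we write j = suc i, so x_{j-1} = i.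
data Relator (ps : List ℕ) : List ℕ → Set where
  invol   : ∀ j → Relator ps (j ∷ j ∷ [])
  braid   : ∀ i q → entry ps (suc i) ≡ just q →
            Relator ps (pow (i ∷ suc i ∷ []) q)
  commute : ∀ j k → 2 ≤ ∣ j - k ∣ → Relator ps (j ∷ k ∷ j ∷ k ∷ [])
  rEE     : ∀ i a b → entry ps (suc i) ≡ just a → entry ps (suc (suc i)) ≡ just b →
            2 ∣ a → 2 ∣ b →
            Relator ps (pow (i ∷ suc i ∷ suc (suc i) ∷ suc i ∷ []) 2)
  rOE     : ∀ i a b → entry ps (suc i) ≡ just a → entry ps (suc (suc i)) ≡ just b →
            ¬ (2 ∣ a) → 2 ∣ b →
            Relator ps (pow (i ∷ suc i ∷ suc (suc i) ∷ suc i ∷ suc (suc i) ∷ []) 2)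
  rEO     : ∀ i a b → entry ps (suc i) ≡ just a → entry ps (suc (suc i)) ≡ just b →
            2 ∣ a → ¬ (2 ∣ b) →
            Relator ps (pow (suc (suc i) ∷ suc i ∷ i ∷ suc i ∷ i ∷ []) 2)

Gen : List ℕ → Set
Gen ps = Fin (suc (length ps))

-- Elements of Γ(ps) are represented by words in the generators (each
-- generator is an involution, so no inverse letters are needed).
Word : List ℕ → Set
Word ps = List (Gen ps)

relWord : (ps : List ℕ) → List (Gen ps) → List ℕ
relWord ps [] = []
relWord ps (a ∷ w) = toℕ a ∷ relWord ps w

data ΓEq (ps : List ℕ) : Word ps → Word ps → Set where
  ≈-refl  : ∀ {u} → ΓEq ps u u
  ≈-sym   : ∀ {u v} → ΓEq ps u v → ΓEq ps v u
  ≈-trans : ∀ {u v w} → ΓEq ps u v → ΓEq ps v w → ΓEq ps u w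
  ≈-rel   : ∀ u r v → Relator ps (relWord ps r) → ΓEq ps (u ++ r ++ v) (u ++ v)

record GroupIso (A B : Set) (_≈₁_ : A → A → Set) (_≈₂_ : B → B → Set)
                (_·₁_ : A → A → A) (_·₂_ : B → B → B) : Set where
  field
    to        : A → B
    from      : B → A
    to-cong   : ∀ {x y} → x ≈₁ y → to x ≈₂ to y
    from-cong : ∀ {x y} → x ≈₂ y → from x ≈₁ from y
    to-hom    : ∀ x y → to (x ·₁ y) ≈₂ (to x ·₂ to y)
    to-from   : ∀ y → to (from y) ≈₂ y
    from-to   : ∀ x → from (to x) ≈₁ x

-- The subgroup of Γ(ps) generated by the generators x_j with P j:
-- words in those generators, with equality and product inherited from Γ(ps).
SubWord : (ps : List ℕ) → (ℕ → Set) → Set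
SubWord ps P = Σ (Word ps) (All (λ a → P (toℕ a)))

_≈sub_ : {ps : List ℕ} {P : ℕ → Set} → SubWord ps P → SubWord ps P → Set
_≈sub_ {ps} u v = ΓEq ps (proj₁ u) (proj₁ v)

_·sub_ : {ps : List ℕ} {P : ℕ → Set} → SubWord ps P → SubWord ps P → SubWord ps P
(u , pu) ·sub (v , pv) = (u ++ v , ++⁺ pu pv)

_≈Γ_ : {ps : List ℕ} → Word ps → Word ps → Set
_≈Γ_ {ps} u v = ΓEq ps u v

_·Γ_ : {ps : List ℕ} → Word ps → Word ps → Word ps
u ·Γ v = u ++ v

IsoLow : List ℕ → ℕ → Set
IsoLow ps i = GroupIso (SubWord ps (λ j → j ≤ i)) (Word (take i ps))
                       (_≈sub_ {ps} {λ j → j ≤ i}) (_≈Γ_ {take i ps}) (_·sub_ {ps} {λ j → j ≤ i}) (_·Γ_ {take i ps})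

IsoHigh : List ℕ → ℕ → Set
IsoHigh ps i = GroupIso (SubWord ps (λ j → i ∸ 1 ≤ j)) (Word (drop (i ∸ 1) ps))
                        (_≈sub_ {ps} {λ j → i ∸ 1 ≤ j}) (_≈Γ_ {drop (i ∸ 1) ps}) (_·sub_ {ps} {λ j → i ∸ 1 ≤ j}) (_·Γ_ {drop (i ∸ 1) ps})

-- Let ι send the generators of Γ(p_1,…,p_i) (resp. Γ(p_i,…,p_{n-1})) to x_0,…,x_i
-- (resp. x_{i-1},…,x_{n-1}). Its relators are relators of Γ(p_1,…,p_{n-1}), so ι is a
-- homomorphism onto the subgroup in question, and it is injective because it has a left
-- inverse: the retraction ρ fixing the retained generators, sending the neighbouring generator
-- x_{i+1} (resp. x_{i-2}) to the nearest retained one x_i (resp. x_{i-1}) if the parameter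
-- between them is odd and to 1 otherwise, and killing all other generators. Relators away from
-- the cut go to relators or to 1; those across it collapse because p_i = 2 lets x_{i-1} and x_i
-- commute, and because admissibility makes the parameter beyond an odd neighbour even.
module Submission where

open import Defs
open import Data.Nat using (ℕ; zero; suc; _+_; _*_; _∸_; _≤_; z≤n; s≤s; ∣_-_∣; _≤?_; _≟_)
open import Data.Nat.Properties
open import Data.Nat.Divisibility using (_∣_; _∣?_; divides)
open import Data.Fin using (Fin; toℕ; fromℕ<; fromℕ)
open import Data.Fin.Properties using (toℕ-fromℕ<; toℕ-injective; toℕ≤pred[n])
open import Data.List using (List; []; _∷_; _++_; length; take; drop; map; concatMap)
open import Data.List.Properties using (map-++; concatMap-++; ++-assoc; ++-identityʳ; length-take; length-drop)
open import Data.List.Relation.Unary.All as All using (All; []; _∷_)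
open import Data.List.Relation.Unary.All.Properties using (map⁺; ++⁺)
open import Data.Maybe using (Maybe; just; nothing)
open import Data.Product using (_×_; _,_; ∃-syntax; proj₁)
open import Data.Empty using (⊥; ⊥-elim)
open import Function using (_∘_)
open import Relation.Nullary using (¬_; yes; no)
open import Relation.Binary.PropositionalEquality

-- Reads k as one of the generators 0,…,n; an out-of-range k becomes the junk value n.
clamp : (n : ℕ) → ℕ → Fin (suc n)
clamp n k with k ≤? n
... | yes k≤n = fromℕ< (s≤s k≤n)
... | no _    = fromℕ n

toℕ-clamp : ∀ n {k} → k ≤ n → toℕ (clamp n k) ≡ k
toℕ-clamp n {k} k≤n with k ≤? n
... | yes k≤n' = toℕ-fromℕ< (s≤s k≤n')
... | no k≰n   = ⊥-elim (k≰n k≤n)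

clamp-toℕ : ∀ n (a : Fin (suc n)) → clamp n (toℕ a) ≡ a
clamp-toℕ n a = toℕ-injective (toℕ-clamp n (toℕ≤pred[n] a))

relWord≡map-toℕ : ∀ ps (w : Word ps) → relWord ps w ≡ map toℕ w
relWord≡map-toℕ ps []      = refl
relWord≡map-toℕ ps (a ∷ w) = cong (toℕ a ∷_) (relWord≡map-toℕ ps w)

All-toℕ≤ : ∀ {n} (w : List (Fin (suc n))) → All (_≤ n) (map toℕ w)
All-toℕ≤ w = map⁺ (All.tabulate λ {a} _ → toℕ≤pred[n] a)

map-pow : ∀ {A B : Set} (f : A → B) (w : List A) q → map f (pow w q) ≡ pow (map f w) q
map-pow f w zero    = refl
map-pow f w (suc q) = trans (map-++ f w (pow w q)) (cong (map f w ++_) (map-pow f w q))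

concatMap-pow : ∀ {A B : Set} (f : A → List B) (w : List A) q →
                concatMap f (pow w q) ≡ pow (concatMap f w) q
concatMap-pow f w zero    = refl
concatMap-pow f w (suc q) =
  trans (concatMap-++ f w (pow w q)) (cong (concatMap f w ++_) (concatMap-pow f w q))

All-pow : ∀ {A : Set} {P : A → Set} {w : List A} q → All P w → All P (pow w q)
All-pow zero    _  = []
All-pow (suc q) pw = ++⁺ pw (All-pow q pw)

module Presentation (qs : List ℕ) where

  ≡⇒≈ : ∀ {u v} → u ≡ v → ΓEq qs u v
  ≡⇒≈ refl = ≈-refl

  ≈-cong : ∀ {x y} u v → ΓEq qs x y → ΓEq qs (u ++ x ++ v) (u ++ y ++ v)
  ≈-cong u v ≈-refl          = ≈-refl
  ≈-cong u v (≈-sym p)       = ≈-sym (≈-cong u v p)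
  ≈-cong u v (≈-trans p q)   = ≈-trans (≈-cong u v p) (≈-cong u v q)
  ≈-cong u v (≈-rel a r b x) =
    ≈-trans (≡⇒≈ reassoc₁) (≈-trans (≈-rel (u ++ a) r (b ++ v) x) (≡⇒≈ reassoc₂))
    where
    reassoc₁ : u ++ (a ++ r ++ b) ++ v ≡ (u ++ a) ++ r ++ (b ++ v)
    reassoc₁ = trans (cong (u ++_) (trans (++-assoc a (r ++ b) v) (cong (a ++_) (++-assoc r b v))))
                     (sym (++-assoc u a (r ++ (b ++ v))))
    reassoc₂ : (u ++ a) ++ (b ++ v) ≡ u ++ (a ++ b) ++ v
    reassoc₂ = trans (++-assoc u a (b ++ v)) (cong (u ++_) (sym (++-assoc a b v)))

  letters : List ℕ → Word qs
  letters = map (clamp (length qs))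

  -- A record, so that x and y can be inferred from a proof although letters is not injective.
  infix 4 _~_
  record _~_ (x y : List ℕ) : Set where
    constructor mk~
    field un~ : ΓEq qs (letters x) (letters y)
  open _~_ public

  ~-refl : ∀ {x} → x ~ x
  ~-refl = mk~ ≈-refl

  ~-sym : ∀ {x y} → x ~ y → y ~ x
  ~-sym (mk~ p) = mk~ (≈-sym p)

  ~-trans : ∀ {x y z} → x ~ y → y ~ z → x ~ z
  ~-trans (mk~ p) (mk~ q) = mk~ (≈-trans p q)

  ~-cong : ∀ {x y} u v → x ~ y → u ++ x ++ v ~ u ++ y ++ v
  ~-cong {x} {y} u v (mk~ p) =
    mk~ (subst₂ (ΓEq qs) (sym (letters-++₃ x)) (sym (letters-++₃ y)) (≈-cong (letters u) (letters v) p))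
    where
    letters-++₃ : ∀ z → letters (u ++ z ++ v) ≡ letters u ++ letters z ++ letters v
    letters-++₃ z = trans (map-++ _ u (z ++ v)) (cong (letters u ++_) (map-++ _ z v))

  relWord-letters : ∀ R → All (_≤ length qs) R → relWord qs (letters R) ≡ R
  relWord-letters []      []       = refl
  relWord-letters (k ∷ R) (k≤ ∷ R≤) = cong₂ _∷_ (toℕ-clamp _ k≤) (relWord-letters R R≤)

  relator~[] : ∀ R → Relator qs R → All (_≤ length qs) R → R ~ []
  relator~[] R r R≤ =
    mk~ (≈-trans (≡⇒≈ (sym (++-identityʳ (letters R))))
                 (≈-rel [] (letters R) [] (subst (Relator qs) (sym (relWord-letters R R≤)) r)))

  xx~[] : ∀ x → x ≤ length qs → x ∷ x ∷ [] ~ []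
  xx~[] x x≤ = relator~[] _ (invol x) (x≤ ∷ x≤ ∷ [])

  cancel : ∀ u {v} x → x ≤ length qs → u ++ x ∷ x ∷ v ~ u ++ v
  cancel u {v} x x≤ = ~-cong u v (xx~[] x x≤)

  pow~[] : ∀ w q → w ~ [] → pow w q ~ []
  pow~[] w zero    w~[] = ~-refl
  pow~[] w (suc q) w~[] = ~-trans (~-cong [] (pow w q) w~[]) (pow~[] w q w~[])

  even-pow~[] : ∀ x q → x ≤ length qs → 2 ∣ q → pow (x ∷ []) q ~ []
  even-pow~[] x q x≤ (divides k refl) = pow-double k
    where
    pow-double : ∀ k → pow (x ∷ []) (k * 2) ~ []
    pow-double zero    = ~-refl
    pow-double (suc k) = ~-trans (cancel [] x x≤) (pow-double k)

module Retraction
  (ps qs : List ℕ) (d : ℕ) (P : ℕ → Set) (ρ : ℕ → List ℕ)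
  (fits        : d + length qs ≤ length ps)
  (entry-shift : ∀ m x → entry qs (suc m) ≡ just x → entry ps (suc (d + m)) ≡ just x)
  (ρ-shift     : ∀ m → m ≤ length qs → ρ (d + m) ≡ m ∷ [])
  (P⇒shift     : ∀ j → j ≤ length ps → P j → ∃[ m ] j ≡ d + m × m ≤ length qs)
  (shift⇒P     : ∀ m → m ≤ length qs → P (d + m))
  (ρ-kills     : ∀ R → Relator ps R → All (_≤ length ps) R →
                 Presentation._~_ qs (concatMap ρ R) [])
  where
  open Presentation qs

  retract : Word ps → Word qs
  retract w = letters (concatMap ρ (map toℕ w))

  include : Word qs → Word ps
  include = map (λ b → clamp (length ps) (d + toℕ b))

  retract-++ : ∀ u v → retract (u ++ v) ≡ retract u ++ retract v
  retract-++ u v rewrite map-++ toℕ u v | concatMap-++ ρ (map toℕ u) (map toℕ v) =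
    map-++ _ (concatMap ρ (map toℕ u)) (concatMap ρ (map toℕ v))

  shift≤ : ∀ (b : Fin (suc (length qs))) → d + toℕ b ≤ length ps
  shift≤ b = ≤-trans (+-monoʳ-≤ d (toℕ≤pred[n] b)) fits

  include-P : ∀ y → All (λ a → P (toℕ a)) (include y)
  include-P []      = []
  include-P (b ∷ y) =
    subst P (sym (toℕ-clamp _ (shift≤ b))) (shift⇒P (toℕ b) (toℕ≤pred[n] b)) ∷ include-P y

  entry-shift₂ : ∀ i b → entry qs (suc (suc i)) ≡ just b → entry ps (suc (suc (d + i))) ≡ just b
  entry-shift₂ i b eb = subst (λ z → entry ps (suc z) ≡ just b) (+-suc d i) (entry-shift (suc i) b eb)

  shift-relator : ∀ {R} → Relator qs R → Relator ps (map (d +_) R)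
  shift-relator (invol j) = invol (d + j)
  shift-relator (braid i q e) rewrite map-pow (d +_) (i ∷ suc i ∷ []) q | +-suc d i =
    braid (d + i) q (entry-shift i q e)
  shift-relator (commute j k h) =
    commute (d + j) (d + k) (subst (2 ≤_) (sym (∣m+n-m+o∣≡∣n-o∣ d j k)) h)
  shift-relator (rEE i a b ea eb pa pb) rewrite +-suc d (suc i) | +-suc d i =
    rEE (d + i) a b (entry-shift i a ea) (entry-shift₂ i b eb) pa pb
  shift-relator (rOE i a b ea eb oa pb) rewrite +-suc d (suc i) | +-suc d i =
    rOE (d + i) a b (entry-shift i a ea) (entry-shift₂ i b eb) oa pb
  shift-relator (rEO i a b ea eb pa ob) rewrite +-suc d (suc i) | +-suc d i =
    rEO (d + i) a b (entry-shift i a ea) (entry-shift₂ i b eb) pa ob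

  relWord-include : ∀ r → relWord ps (include r) ≡ map (d +_) (relWord qs r)
  relWord-include []      = refl
  relWord-include (b ∷ r) = cong₂ _∷_ (toℕ-clamp _ (shift≤ b)) (relWord-include r)

  retract-cong : ∀ {u v} → ΓEq ps u v → ΓEq qs (retract u) (retract v)
  retract-cong ≈-refl          = ≈-refl
  retract-cong (≈-sym p)       = ≈-sym (retract-cong p)
  retract-cong (≈-trans p q)   = ≈-trans (retract-cong p) (retract-cong q)
  retract-cong (≈-rel a r b x) =
    ≈-trans (≡⇒≈ (trans (retract-++ a (r ++ b)) (cong (retract a ++_) (retract-++ r b))))
      (≈-trans (≈-cong (retract a) (retract b) r↦1) (≡⇒≈ (sym (retract-++ a b))))
    where
    r↦1 : ΓEq qs (retract r) []
    r↦1 = un~ (ρ-kills (map toℕ r) (subst (Relator ps) (relWord≡map-toℕ ps r) x) (All-toℕ≤ r))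

  include-cong : ∀ {u v} → ΓEq qs u v → ΓEq ps (include u) (include v)
  include-cong ≈-refl          = ≈-refl
  include-cong (≈-sym p)       = ≈-sym (include-cong p)
  include-cong (≈-trans p q)   = ≈-trans (include-cong p) (include-cong q)
  include-cong (≈-rel a r b x) =
    subst₂ (ΓEq ps) (sym (trans (map-++ _ a (r ++ b)) (cong (include a ++_) (map-++ _ r b))))
                    (sym (map-++ _ a b))
      (≈-rel (include a) (include r) (include b)
             (subst (Relator ps) (sym (relWord-include r)) (shift-relator x)))

  retract∘include : ∀ y → retract (include y) ≡ y
  retract∘include []      = refl
  retract∘include (b ∷ y)
    rewrite toℕ-clamp (length ps) (shift≤ b) | ρ-shift (toℕ b) (toℕ≤pred[n] b)
          | clamp-toℕ (length qs) b | retract∘include y = refl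

  include∘retract : ∀ w → All (λ a → P (toℕ a)) w → include (retract w) ≡ w
  include∘retract []      []         = refl
  include∘retract (a ∷ w) (Pa ∷ Pw) with P⇒shift (toℕ a) (toℕ≤pred[n] a) Pa
  ... | m , a≡d+m , m≤ =
    trans (cong (λ z → include (letters (z ++ concatMap ρ (map toℕ w)))) (trans (cong ρ a≡d+m) (ρ-shift m m≤)))
          (cong₂ _∷_ include-m≡a (include∘retract w Pw))
    where
    include-m≡a : clamp (length ps) (d + toℕ (clamp (length qs) m)) ≡ a
    include-m≡a = begin
      clamp (length ps) (d + toℕ (clamp (length qs) m)) ≡⟨ cong (λ z → clamp (length ps) (d + z)) (toℕ-clamp _ m≤) ⟩
      clamp (length ps) (d + m)                         ≡⟨ cong (clamp (length ps)) (sym a≡d+m) ⟩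
      clamp (length ps) (toℕ a)                         ≡⟨ clamp-toℕ (length ps) a ⟩
      a                                                 ∎
      where open ≡-Reasoning

  iso : GroupIso (SubWord ps P) (Word qs) (_≈sub_ {ps} {P}) (_≈Γ_ {qs}) (_·sub_ {ps} {P}) (_·Γ_ {qs})
  iso = record
    { to        = λ x → retract (proj₁ x)
    ; from      = λ y → include y , include-P y
    ; to-cong   = retract-cong
    ; from-cong = include-cong
    ; to-hom    = λ x y → ≡⇒≈ (retract-++ (proj₁ x) (proj₁ y))
    ; to-from   = λ y → ≡⇒≈ (retract∘include y)
    ; from-to   = λ { (w , Pw) → Presentation.≡⇒≈ ps (include∘retract w Pw) }
    }

entry-take : ∀ k ps {m} → suc m ≤ k → entry (take k ps) (suc m) ≡ entry ps (suc m)
entry-take (suc k) []       _         = refl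
entry-take (suc k) (p ∷ ps) {zero}  _ = refl
entry-take (suc k) (p ∷ ps) {suc m} (s≤s m<k) = entry-take k ps m<k

entry-take⇒entry : ∀ k ps j {x} → entry (take k ps) j ≡ just x → entry ps j ≡ just x
entry-take⇒entry (suc k) (p ∷ ps) (suc zero)    e = e
entry-take⇒entry (suc k) (p ∷ ps) (suc (suc j)) e = entry-take⇒entry k ps (suc j) e

entry-drop : ∀ e ps m → entry (drop e ps) (suc m) ≡ entry ps (suc (e + m))
entry-drop zero    ps       m = refl
entry-drop (suc e) []       m = refl
entry-drop (suc e) (p ∷ ps) m = entry-drop e ps m

entry⇒≤length : ∀ ps m {x} → entry ps (suc m) ≡ just x → suc m ≤ length ps
entry⇒≤length (p ∷ ps) zero    _ = s≤s z≤n
entry⇒≤length (p ∷ ps) (suc m) e = s≤s (entry⇒≤length ps m e)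

parity-clash : ∀ {p : Maybe ℕ} {a b} → p ≡ just a → p ≡ just b → ¬ 2 ∣ a → 2 ∣ b → ⊥
parity-clash refl refl 2∤a 2∣b = 2∤a 2∣b

∣n-1+n∣≡1 : ∀ n → ∣ n - suc n ∣ ≡ 1
∣n-1+n∣≡1 zero    = refl
∣n-1+n∣≡1 (suc n) = ∣n-1+n∣≡1 n

2+m≤n⇒2≤∣m-n∣ : ∀ {m n} → 2 + m ≤ n → 2 ≤ ∣ m - n ∣
2+m≤n⇒2≤∣m-n∣ {zero}  2≤n       = 2≤n
2+m≤n⇒2≤∣m-n∣ {suc m} (s≤s 2+m≤n) = 2+m≤n⇒2≤∣m-n∣ 2+m≤n

∣n-n∣≱2 : ∀ n → ¬ 2 ≤ ∣ n - n ∣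
∣n-n∣≱2 n h with subst (2 ≤_) (∣n-n∣≡0 n) h
... | ()

2≤∣1+k+m-k∣⇒1≤m : ∀ k m → 2 ≤ ∣ suc k + m - k ∣ → 1 ≤ m
2≤∣1+k+m-k∣⇒1≤m k zero    2≤∣1+k-k∣ = ⊥-elim (1+n≰n (subst (2 ≤_) ∣1+k-k∣≡1 2≤∣1+k-k∣))
  where
  ∣1+k-k∣≡1 : ∣ suc k + 0 - k ∣ ≡ 1
  ∣1+k-k∣≡1 = trans (cong (λ z → ∣ z - k ∣) (+-identityʳ (suc k))) (trans (∣-∣-comm (suc k) k) (∣n-1+n∣≡1 k))
2≤∣1+k+m-k∣⇒1≤m k (suc m) _ = s≤s z≤n

-- Image of the generator adjacent to the retained block, p being the parameter between it
-- and its retained neighbour x.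
data NeighbourImage (p : Maybe ℕ) (x : ℕ) : List ℕ → Set where
  odd  : ∀ a → p ≡ just a → ¬ 2 ∣ a → NeighbourImage p x (x ∷ [])
  even : (∀ a → p ≡ just a → 2 ∣ a) → NeighbourImage p x []

neighbourImage : ∀ p x → ∃[ g ] NeighbourImage p x g
neighbourImage nothing  x = [] , even (λ _ ())
neighbourImage (just a) x with 2 ∣? a
... | yes 2∣a = [] , even (λ { _ refl → 2∣a })
... | no  2∤a = x ∷ [] , odd a refl 2∤a

lowerρ : ℕ → List ℕ → ℕ → List ℕ
lowerρ i g k with k ≤? i
... | yes _ = k ∷ []
... | no _ with k ≟ suc i
...   | yes _ = g
...   | no _  = []

lowerρ-≤ : ∀ {i} g {k} → k ≤ i → lowerρ i g k ≡ k ∷ []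
lowerρ-≤ {i} g {k} k≤i with k ≤? i
... | yes _   = refl
... | no  k≰i = ⊥-elim (k≰i k≤i)

lowerρ-next : ∀ i g → lowerρ i g (suc i) ≡ g
lowerρ-next i g with suc i ≤? i
... | yes 1+i≤i = ⊥-elim (1+n≰n 1+i≤i)
... | no _ with suc i ≟ suc i
...   | yes _   = refl
...   | no  ≢   = ⊥-elim (≢ refl)

lowerρ-far : ∀ {i} g {k} → 2 + i ≤ k → lowerρ i g k ≡ []
lowerρ-far {i} g {k} 2+i≤k with k ≤? i
... | yes k≤i = ⊥-elim (1+n≰n (≤-trans 2+i≤k (m≤n⇒m≤1+n k≤i)))
... | no _ with k ≟ suc i
...   | yes refl = ⊥-elim (1+n≰n 2+i≤k)
...   | no _     = refl

data LowerLetter (i k : ℕ) : Set where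
  inside : k ≤ i → LowerLetter i k
  next   : k ≡ suc i → LowerLetter i k
  far    : 2 + i ≤ k → LowerLetter i k

lowerLetter : ∀ i k → LowerLetter i k
lowerLetter i k with k ≤? i
... | yes k≤i = inside k≤i
... | no  k≰i with k ≟ suc i
...   | yes k≡1+i = next k≡1+i
...   | no  k≢1+i = far (≤∧≢⇒< (≰⇒> k≰i) (k≢1+i ∘ sym))

data LowerWindow (i j : ℕ) : Set where
  inside : 2 + j ≤ i → LowerWindow i j
  last   : suc j ≡ i → LowerWindow i j
  top    : j ≡ i → LowerWindow i j
  next   : j ≡ suc i → LowerWindow i j
  far    : 2 + i ≤ j → LowerWindow i j

lowerWindow : ∀ i j → LowerWindow i j
lowerWindow zero          zero          = top refl
lowerWindow zero          (suc zero)    = next refl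
lowerWindow zero          (suc (suc j)) = far (s≤s (s≤s z≤n))
lowerWindow (suc zero)    zero          = last refl
lowerWindow (suc (suc i)) zero          = inside (s≤s (s≤s z≤n))
lowerWindow (suc i)       (suc j) with lowerWindow i j
... | inside p = inside (s≤s p)
... | last   p = last (cong suc p)
... | top    p = top (cong suc p)
... | next   p = next (cong suc p)
... | far    p = far (s≤s p)

module Lower (ps : List ℕ) (adm : Admissible ps) (i₀ : ℕ)
             (p≡2 : entry ps (suc i₀) ≡ just 2) (i≤n : suc i₀ ≤ length ps) where
  open Admissible adm

  i : ℕ
  i = suc i₀

  qs : List ℕ
  qs = take i ps

  open Presentation qs

  length-qs : length qs ≡ i
  length-qs = trans (length-take i ps) (m≤n⇒m⊓n≡m i≤n)

  inQ : ∀ {c} → c ≤ i → c ≤ length qs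
  inQ {c} = subst (c ≤_) (sym length-qs)

  i∈Q : i ≤ length qs
  i∈Q = inQ ≤-refl

  i₀∈Q : i₀ ≤ length qs
  i₀∈Q = inQ (n≤1+n i₀)

  x₀≤i : ∀ {j} → 2 + j ≤ i → j ≤ i
  x₀≤i = m+n≤o⇒n≤o 2

  x₁≤i : ∀ {j} → 2 + j ≤ i → suc j ≤ i
  x₁≤i = m+n≤o⇒n≤o 1

  x₁-far : ∀ {j} → 2 + i ≤ j → 2 + i ≤ suc j
  x₁-far = m≤n⇒m≤1+n

  x₂-far : ∀ {j} → 2 + i ≤ j → 2 + i ≤ suc (suc j)
  x₂-far = m≤n⇒m≤1+n ∘ m≤n⇒m≤1+n

  entry-qs : ∀ {m x} → suc m ≤ i → entry ps (suc m) ≡ just x → entry qs (suc m) ≡ just x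
  entry-qs {m} m<i = trans (entry-take i ps m<i)

  xᵢ-commutes : ∀ c → suc c ≤ i → c ∷ i ∷ c ∷ i ∷ [] ~ []
  xᵢ-commutes c c<i with c ≟ i₀
  ... | yes refl = relator~[] _ (braid i₀ 2 (entry-qs ≤-refl p≡2)) (i₀∈Q ∷ i∈Q ∷ i₀∈Q ∷ i∈Q ∷ [])
  ... | no  c≢i₀ = relator~[] _ (commute c i (2+m≤n⇒2≤∣m-n∣ (s≤s (≤∧≢⇒< (≤-pred c<i) c≢i₀))))
                                 (c∈Q ∷ i∈Q ∷ c∈Q ∷ i∈Q ∷ [])
    where c∈Q = inQ (m≤n⇒m≤1+n (≤-pred c<i))

  xᵢ-commutes′ : ∀ c → suc c ≤ i → i ∷ c ∷ i ∷ c ∷ [] ~ []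
  xᵢ-commutes′ c c<i =
    ~-trans (~-sym (cancel (i ∷ c ∷ i ∷ c ∷ []) i i∈Q))
            (~-trans (~-cong (i ∷ []) (i ∷ []) (xᵢ-commutes c c<i)) (xx~[] i i∈Q))

  Image : List ℕ → Set
  Image = NeighbourImage (entry ps (suc i)) i

  Killed : List ℕ → List ℕ → Set
  Killed g R = concatMap (lowerρ i g) R ~ []

  image-involution : ∀ {g} → Image g → g ++ g ++ [] ~ []
  image-involution (odd _ _ _) = xx~[] i i∈Q
  image-involution (even _)    = ~-refl

  image-commutes : ∀ {g} → Image g → ∀ c → suc c ≤ i → c ∷ g ++ c ∷ g ++ [] ~ []
  image-commutes (odd _ _ _) c c<i = xᵢ-commutes c c<i
  image-commutes (even _)    c c<i = xx~[] c (inQ (<⇒≤ c<i))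

  image-commutes′ : ∀ {g} → Image g → ∀ c → suc c ≤ i → g ++ c ∷ g ++ c ∷ [] ~ []
  image-commutes′ (odd _ _ _) c c<i = xᵢ-commutes′ c c<i
  image-commutes′ (even _)    c c<i = xx~[] c (inQ (<⇒≤ c<i))

  kills-invol : ∀ g → Image g → ∀ j → Killed g (j ∷ j ∷ [])
  kills-invol g img j with lowerLetter i j
  ... | inside j≤i  rewrite lowerρ-≤ g j≤i   = xx~[] j (inQ j≤i)
  ... | next refl   rewrite lowerρ-next i g  = image-involution img
  ... | far 2+i≤j   rewrite lowerρ-far g 2+i≤j = ~-refl

  far⇒< : ∀ {c} → c ≤ i → 2 ≤ ∣ c - suc i ∣ → suc c ≤ i
  far⇒< c≤i 2≤∣c-1+i∣ = ≤∧≢⇒< c≤i λ { refl → 1+n≰n (subst (2 ≤_) (∣n-1+n∣≡1 i) 2≤∣c-1+i∣) }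

  kills-commute : ∀ g → Image g → ∀ j k → 2 ≤ ∣ j - k ∣ → Killed g (j ∷ k ∷ j ∷ k ∷ [])
  kills-commute g img j k 2≤∣j-k∣ with lowerLetter i j | lowerLetter i k
  ... | inside j≤i | inside k≤i rewrite lowerρ-≤ g j≤i | lowerρ-≤ g k≤i =
    relator~[] _ (commute j k 2≤∣j-k∣) (inQ j≤i ∷ inQ k≤i ∷ inQ j≤i ∷ inQ k≤i ∷ [])
  ... | inside j≤i | next refl rewrite lowerρ-≤ g j≤i | lowerρ-next i g =
    image-commutes img j (far⇒< j≤i 2≤∣j-k∣)
  ... | inside j≤i | far k-far rewrite lowerρ-≤ g j≤i | lowerρ-far g k-far = xx~[] j (inQ j≤i)
  ... | next refl | inside k≤i rewrite lowerρ-next i g | lowerρ-≤ g k≤i =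
    image-commutes′ img k (far⇒< k≤i (subst (2 ≤_) (∣-∣-comm j k) 2≤∣j-k∣))
  ... | next refl | next refl = ⊥-elim (∣n-n∣≱2 j 2≤∣j-k∣)
  ... | next refl | far k-far rewrite lowerρ-next i g | lowerρ-far g k-far = image-involution img
  ... | far j-far | inside k≤i rewrite lowerρ-far g j-far | lowerρ-≤ g k≤i = xx~[] k (inQ k≤i)
  ... | far j-far | next refl rewrite lowerρ-far g j-far | lowerρ-next i g = image-involution img
  ... | far j-far | far k-far rewrite lowerρ-far g j-far | lowerρ-far g k-far = ~-refl

  concatMap-lowerρ-≤ : ∀ g R → All (_≤ i) R → concatMap (lowerρ i g) R ≡ R
  concatMap-lowerρ-≤ g []      []          = refl
  concatMap-lowerρ-≤ g (k ∷ R) (k≤i ∷ R≤i) rewrite lowerρ-≤ g k≤i = cong (k ∷_) (concatMap-lowerρ-≤ g R R≤i)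

  kills-inside : ∀ g {R} → Relator qs R → All (_≤ i) R → Killed g R
  kills-inside g {R} r R≤i =
    subst (_~ []) (sym (concatMap-lowerρ-≤ g R R≤i)) (relator~[] R r (All.map inQ R≤i))

  kills-erased : ∀ g R → All (λ k → lowerρ i g k ≡ []) R → Killed g R
  kills-erased g []      []          = ~-refl
  kills-erased g (k ∷ R) (k↦1 ∷ R↦1) rewrite k↦1 = kills-erased g R R↦1

  kills-far : ∀ g R → All (2 + i ≤_) R → Killed g R
  kills-far g R R-far = kills-erased g R (All.map (lowerρ-far g) R-far)

  kills-braid : ∀ g → Image g → ∀ {j} → LowerWindow i j → ∀ q → entry ps (suc j) ≡ just q →
                Killed g (pow (j ∷ suc j ∷ []) q)
  kills-braid g _ (inside p) q e =
    kills-inside g (braid _ q (entry-qs (x₁≤i p) e)) (All-pow q (x₀≤i p ∷ x₁≤i p ∷ []))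
  kills-braid g _ (last refl) q e =
    kills-inside g (braid i₀ q (entry-qs ≤-refl e)) (All-pow q (n≤1+n i₀ ∷ ≤-refl ∷ []))
  kills-braid _ (odd _ _ _) (top refl) q e
    rewrite concatMap-pow (lowerρ i (i ∷ [])) (i ∷ suc i ∷ []) q
          | lowerρ-≤ (i ∷ []) (≤-refl {i})
          | lowerρ-next i (i ∷ []) =
    pow~[] _ q (xx~[] i i∈Q)
  kills-braid _ (even 2∣) (top refl) q e
    rewrite concatMap-pow (lowerρ i []) (i ∷ suc i ∷ []) q | lowerρ-≤ [] (≤-refl {i}) | lowerρ-next i [] =
    even-pow~[] i q i∈Q (2∣ q e)
  kills-braid _ (odd a ea 2∤a) (next refl) q e
    rewrite concatMap-pow (lowerρ i (i ∷ [])) (suc i ∷ suc (suc i) ∷ []) q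
          | lowerρ-next i (i ∷ []) | lowerρ-far (i ∷ []) (≤-refl {2 + i}) =
    even-pow~[] i q i∈Q (proj₁ (rightNb i a q ea 2∤a e))
  kills-braid _ (even _) (next refl) q e =
    kills-erased [] _ (All-pow q (lowerρ-next i [] ∷ lowerρ-far [] (≤-refl {2 + i}) ∷ []))
  kills-braid g _ (far p) q e = kills-far g _ (All-pow q (p ∷ x₁-far p ∷ []))

  kills-rEE : ∀ g → Image g → ∀ {j} → LowerWindow i j → ∀ a b →
              entry ps (suc j) ≡ just a → entry ps (suc (suc j)) ≡ just b → 2 ∣ a → 2 ∣ b →
              Killed g (pow (j ∷ suc j ∷ suc (suc j) ∷ suc j ∷ []) 2)
  kills-rEE g _ (inside p) a b ea eb 2∣a 2∣b =
    kills-inside g (rEE _ a b (entry-qs (x₁≤i p) ea) (entry-qs p eb) 2∣a 2∣b)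
      (All-pow 2 (x₀≤i p ∷ x₁≤i p ∷ p ∷ x₁≤i p ∷ []))
  kills-rEE _ (odd _ e 2∤) (last refl) a b ea eb 2∣a 2∣b = ⊥-elim (parity-clash e eb 2∤ 2∣b)
  kills-rEE _ (even _) (last refl) a b ea eb 2∣a 2∣b
    rewrite lowerρ-≤ [] (n≤1+n i₀) | lowerρ-≤ [] (≤-refl {i}) | lowerρ-next i [] =
    ~-trans (cancel (i₀ ∷ []) i i∈Q) (~-trans (cancel [] i₀ i₀∈Q) (xx~[] i i∈Q))
  kills-rEE _ (odd _ e 2∤) (top refl) a b ea eb 2∣a 2∣b = ⊥-elim (parity-clash e ea 2∤ 2∣a)
  kills-rEE _ (even _) (top refl) a b ea eb 2∣a 2∣b
    rewrite lowerρ-≤ [] (≤-refl {i}) | lowerρ-next i [] | lowerρ-far [] (≤-refl {2 + i}) = xx~[] i i∈Q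
  kills-rEE g img (next refl) a b ea eb 2∣a 2∣b
    rewrite lowerρ-next i g
          | lowerρ-far g (≤-refl {2 + i})
          | lowerρ-far g (n≤1+n (2 + i)) = image-involution img
  kills-rEE g _ (far p) a b ea eb 2∣a 2∣b =
    kills-far g _ (All-pow 2 (p ∷ x₁-far p ∷ x₂-far p ∷ x₁-far p ∷ []))

  kills-rOE : ∀ g → Image g → ∀ {j} → LowerWindow i j → ∀ a b →
              entry ps (suc j) ≡ just a → entry ps (suc (suc j)) ≡ just b → ¬ 2 ∣ a → 2 ∣ b →
              Killed g (pow (j ∷ suc j ∷ suc (suc j) ∷ suc j ∷ suc (suc j) ∷ []) 2)
  kills-rOE g _ (inside p) a b ea eb 2∤a 2∣b =
    kills-inside g (rOE _ a b (entry-qs (x₁≤i p) ea) (entry-qs p eb) 2∤a 2∣b)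
      (All-pow 2 (x₀≤i p ∷ x₁≤i p ∷ p ∷ x₁≤i p ∷ p ∷ []))
  kills-rOE g _ (last refl) a b ea eb 2∤a 2∣b = ⊥-elim (parity-clash ea p≡2 2∤a (divides 1 refl))
  kills-rOE _ (odd _ _ _) (top refl) a b ea eb 2∤a 2∣b
    rewrite lowerρ-≤ (i ∷ []) (≤-refl {i}) | lowerρ-next i (i ∷ []) | lowerρ-far (i ∷ []) (≤-refl {2 + i}) =
    ~-trans (cancel [] i i∈Q) (~-trans (cancel [] i i∈Q) (xx~[] i i∈Q))
  kills-rOE _ (even 2∣) (top refl) a b ea eb 2∤a 2∣b = ⊥-elim (2∤a (2∣ a ea))
  kills-rOE g img (next refl) a b ea eb 2∤a 2∣b
    rewrite lowerρ-next i g
          | lowerρ-far g (≤-refl {2 + i})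
          | lowerρ-far g (n≤1+n (2 + i)) = image-involution img
  kills-rOE g _ (far p) a b ea eb 2∤a 2∣b =
    kills-far g _ (All-pow 2 (p ∷ x₁-far p ∷ x₂-far p ∷ x₁-far p ∷ x₂-far p ∷ []))

  kills-rEO : ∀ g → Image g → ∀ {j} → LowerWindow i j → ∀ a b →
              entry ps (suc j) ≡ just a → entry ps (suc (suc j)) ≡ just b → 2 ∣ a → ¬ 2 ∣ b →
              Killed g (pow (suc (suc j) ∷ suc j ∷ j ∷ suc j ∷ j ∷ []) 2)
  kills-rEO g _ (inside p) a b ea eb 2∣a 2∤b =
    kills-inside g (rEO _ a b (entry-qs (x₁≤i p) ea) (entry-qs p eb) 2∣a 2∤b)
      (All-pow 2 (p ∷ x₁≤i p ∷ x₀≤i p ∷ x₁≤i p ∷ x₀≤i p ∷ []))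
  kills-rEO _ (odd _ _ _) (last refl) a b ea eb 2∣a 2∤b
    rewrite lowerρ-≤ (i ∷ []) (n≤1+n i₀) | lowerρ-≤ (i ∷ []) (≤-refl {i}) | lowerρ-next i (i ∷ []) =
    ~-trans (cancel [] i i∈Q) (~-trans (cancel (i₀ ∷ i ∷ i₀ ∷ []) i i∈Q) (~-trans (cancel (i₀ ∷ i ∷ []) i₀ i₀∈Q)
      (~-trans (cancel (i₀ ∷ []) i i∈Q) (xx~[] i₀ i₀∈Q))))
  kills-rEO _ (even 2∣) (last refl) a b ea eb 2∣a 2∤b = ⊥-elim (2∤b (2∣ b eb))
  kills-rEO _ (odd _ e 2∤) (top refl) a b ea eb 2∣a 2∤b = ⊥-elim (parity-clash e ea 2∤ 2∣a)
  kills-rEO _ (even _) (top refl) a b ea eb 2∣a 2∤b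
    rewrite lowerρ-≤ [] (≤-refl {i}) | lowerρ-next i [] | lowerρ-far [] (≤-refl {2 + i}) =
    ~-trans (cancel [] i i∈Q) (xx~[] i i∈Q)
  kills-rEO _ (odd _ _ _) (next refl) a b ea eb 2∣a 2∤b
    rewrite lowerρ-next i (i ∷ [])
          | lowerρ-far (i ∷ []) (≤-refl {2 + i})
          | lowerρ-far (i ∷ []) (n≤1+n (2 + i)) =
    ~-trans (cancel [] i i∈Q) (xx~[] i i∈Q)
  kills-rEO _ (even _) (next refl) a b ea eb 2∣a 2∤b
    rewrite lowerρ-next i [] | lowerρ-far [] (≤-refl {2 + i}) | lowerρ-far [] (n≤1+n (2 + i)) = ~-refl
  kills-rEO g _ (far p) a b ea eb 2∣a 2∤b =
    kills-far g _ (All-pow 2 (x₂-far p ∷ x₁-far p ∷ p ∷ x₁-far p ∷ p ∷ []))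

  kills : ∀ g → Image g → ∀ R → Relator ps R → Killed g R
  kills g img _ (invol j)                     = kills-invol g img j
  kills g img _ (braid j q e)                 = kills-braid g img (lowerWindow i j) q e
  kills g img _ (commute j k 2≤∣j-k∣)         = kills-commute g img j k 2≤∣j-k∣
  kills g img _ (rEE j a b ea eb 2∣a 2∣b)     = kills-rEE g img (lowerWindow i j) a b ea eb 2∣a 2∣b
  kills g img _ (rOE j a b ea eb 2∤a 2∣b)     = kills-rOE g img (lowerWindow i j) a b ea eb 2∤a 2∣b
  kills g img _ (rEO j a b ea eb 2∣a 2∤b)     = kills-rEO g img (lowerWindow i j) a b ea eb 2∣a 2∤b

  iso : IsoLow ps i
  iso with neighbourImage (entry ps (suc i)) i
  ... | g , img = Retraction.iso ps qs 0 (_≤ i) (lowerρ i g)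
    (subst (_≤ length ps) (sym length-qs) i≤n)
    (λ m _ → entry-take⇒entry i ps (suc m))
    (λ m m≤ → lowerρ-≤ g (subst (m ≤_) length-qs m≤))
    (λ j _ j≤i → j , refl , inQ j≤i)
    (λ m → subst (m ≤_) length-qs)
    (λ R r _ → kills g img R r)

-- upperρ e h sends x_{e+m} to x_m, x_{e-1} to h, and every other generator to 1.
upperρ : ℕ → List ℕ → ℕ → List ℕ
upperρ zero          h k       = k ∷ []
upperρ (suc e)       h (suc k) = upperρ e h k
upperρ (suc zero)    h zero    = h
upperρ (suc (suc e)) h zero    = []

upperρ-+ : ∀ e h m → upperρ e h (e + m) ≡ m ∷ []
upperρ-+ zero    h m = refl
upperρ-+ (suc e) h m = upperρ-+ e h m

upperρ-1+ : ∀ e h m → upperρ e h (suc (e + m)) ≡ suc m ∷ []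
upperρ-1+ zero    h m = refl
upperρ-1+ (suc e) h m = upperρ-1+ e h m

upperρ-2+ : ∀ e h m → upperρ e h (suc (suc (e + m))) ≡ suc (suc m) ∷ []
upperρ-2+ zero    h m = refl
upperρ-2+ (suc e) h m = upperρ-2+ e h m

upperρ-e : ∀ e h → upperρ e h e ≡ 0 ∷ []
upperρ-e zero    h = refl
upperρ-e (suc e) h = upperρ-e e h

upperρ-1+e : ∀ e h → upperρ e h (suc e) ≡ 1 ∷ []
upperρ-1+e zero    h = refl
upperρ-1+e (suc e) h = upperρ-1+e e h

upperρ-next : ∀ j h → upperρ (suc j) h j ≡ h
upperρ-next zero    h = refl
upperρ-next (suc j) h = upperρ-next j h

upperρ-far : ∀ {e} h {k} → 2 + k ≤ e → upperρ e h k ≡ []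
upperρ-far {suc (suc e)} h {zero}  _         = refl
upperρ-far {suc e}       h {suc k} (s≤s 2+k≤e) = upperρ-far h 2+k≤e

data UpperLetter (e k : ℕ) : Set where
  inside : ∀ m → k ≡ e + m → UpperLetter e k
  next   : suc k ≡ e → UpperLetter e k
  far    : 2 + k ≤ e → UpperLetter e k

upperLetter : ∀ e k → UpperLetter e k
upperLetter zero                k       = inside k refl
upperLetter (suc zero)          zero    = next refl
upperLetter (suc (suc e))       zero    = far (s≤s (s≤s z≤n))
upperLetter (suc e)             (suc k) with upperLetter e k
... | inside m p = inside m (cong suc p)
... | next p     = next (cong suc p)
... | far p      = far (s≤s p)

-- nextₙ: the letter j + n of the window j, j+1, j+2 is the neighbour x_{e-1}.
data UpperWindow (e j : ℕ) : Set where
  inside : ∀ m → j ≡ e + m → UpperWindow e j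
  next₀  : suc j ≡ e → UpperWindow e j
  next₁  : 2 + j ≡ e → UpperWindow e j
  next₂  : 3 + j ≡ e → UpperWindow e j
  far    : 4 + j ≤ e → UpperWindow e j

upperWindow : ∀ e j → UpperWindow e j
upperWindow zero                      j       = inside j refl
upperWindow (suc zero)                zero    = next₀ refl
upperWindow (suc (suc zero))          zero    = next₁ refl
upperWindow (suc (suc (suc zero)))    zero    = next₂ refl
upperWindow (suc (suc (suc (suc e)))) zero    = far (s≤s (s≤s (s≤s (s≤s z≤n))))
upperWindow (suc e)                   (suc j) with upperWindow e j
... | inside m p = inside m (cong suc p)
... | next₀ p    = next₀ (cong suc p)
... | next₁ p    = next₁ (cong suc p)
... | next₂ p    = next₂ (cong suc p)
... | far p      = far (s≤s p)

module Upper (ps : List ℕ) (adm : Admissible ps) (e : ℕ)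
             (p≡2 : entry ps (suc e) ≡ just 2) (e<n : suc e ≤ length ps) where
  open Admissible adm

  qs : List ℕ
  qs = drop e ps

  open Presentation qs

  inQ : ∀ {m} → e + m ≤ length ps → m ≤ length qs
  inQ {m} e+m≤n =
    subst (m ≤_) (sym (length-drop e ps)) (m+n≤o⇒m≤o∸n m (subst (_≤ length ps) (+-comm e m) e+m≤n))

  entry-qs : ∀ m {x} → entry ps (suc (e + m)) ≡ just x → entry qs (suc m) ≡ just x
  entry-qs m = trans (entry-drop e ps m)

  entry-qs₂ : ∀ m {x} → entry ps (suc (suc (e + m))) ≡ just x → entry qs (suc (suc m)) ≡ just x
  entry-qs₂ m = trans (trans (entry-drop e ps (suc m)) (cong (λ z → entry ps (suc z)) (+-suc e m)))

  qs-p₁≡2 : entry qs 1 ≡ just 2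
  qs-p₁≡2 = entry-qs 0 (subst (λ z → entry ps (suc z) ≡ just 2) (sym (+-identityʳ e)) p≡2)

  1∈Q : 1 ≤ length qs
  1∈Q = entry⇒≤length qs 0 qs-p₁≡2

  x₀-commutes : ∀ m → 1 ≤ m → m ≤ length qs → 0 ∷ m ∷ 0 ∷ m ∷ [] ~ []
  x₀-commutes (suc zero)    _ _   = relator~[] _ (braid 0 2 qs-p₁≡2) (z≤n ∷ 1∈Q ∷ z≤n ∷ 1∈Q ∷ [])
  x₀-commutes (suc (suc m)) _ m∈Q = relator~[] _ (commute 0 (2 + m) (s≤s (s≤s z≤n))) (z≤n ∷ m∈Q ∷ z≤n ∷ m∈Q ∷ [])

  x₀-commutes′ : ∀ m → 1 ≤ m → m ≤ length qs → m ∷ 0 ∷ m ∷ 0 ∷ [] ~ []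
  x₀-commutes′ m 1≤m m∈Q =
    ~-trans (~-sym (cancel (m ∷ 0 ∷ m ∷ 0 ∷ []) m m∈Q))
            (~-trans (~-cong (m ∷ []) (m ∷ []) (x₀-commutes m 1≤m m∈Q)) (xx~[] m m∈Q))

  Image : List ℕ → Set
  Image = NeighbourImage (entry ps e) 0

  Killed : List ℕ → List ℕ → Set
  Killed h R = concatMap (upperρ e h) R ~ []

  image-involution : ∀ {h} → Image h → h ++ h ++ [] ~ []
  image-involution (odd _ _ _) = xx~[] 0 z≤n
  image-involution (even _)    = ~-refl

  image-commutes : ∀ {h} → Image h → ∀ m → 1 ≤ m → m ≤ length qs → m ∷ h ++ m ∷ h ++ [] ~ []
  image-commutes (odd _ _ _) m 1≤m m∈Q = x₀-commutes′ m 1≤m m∈Q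
  image-commutes (even _)    m 1≤m m∈Q = xx~[] m m∈Q

  image-commutes′ : ∀ {h} → Image h → ∀ m → 1 ≤ m → m ≤ length qs → h ++ m ∷ h ++ m ∷ [] ~ []
  image-commutes′ (odd _ _ _) m 1≤m m∈Q = x₀-commutes m 1≤m m∈Q
  image-commutes′ (even _)    m 1≤m m∈Q = xx~[] m m∈Q

  kills-erased : ∀ h R → All (λ k → upperρ e h k ≡ []) R → Killed h R
  kills-erased h []      []          = ~-refl
  kills-erased h (k ∷ R) (k↦1 ∷ R↦1) rewrite k↦1 = kills-erased h R R↦1

  kills-invol : ∀ h → Image h → ∀ {k} → UpperLetter e k → k ≤ length ps → Killed h (k ∷ k ∷ [])
  kills-invol h _   (inside m refl) k≤n rewrite upperρ-+ e h m = xx~[] m (inQ k≤n)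
  kills-invol h img {k} (next refl) _ rewrite upperρ-next k h = image-involution img
  kills-invol h _   (far 2+k≤e)     _   = kills-erased h _ (upperρ-far h 2+k≤e ∷ upperρ-far h 2+k≤e ∷ [])

  kills-commute : ∀ h → Image h → ∀ {j k} → UpperLetter e j → UpperLetter e k →
                  j ≤ length ps → k ≤ length ps → 2 ≤ ∣ j - k ∣ → Killed h (j ∷ k ∷ j ∷ k ∷ [])
  kills-commute h _ (inside m refl) (inside m′ refl) j≤n k≤n 2≤∣j-k∣ rewrite upperρ-+ e h m | upperρ-+ e h m′ =
    relator~[] _ (commute m m′ (subst (2 ≤_) (∣m+n-m+o∣≡∣n-o∣ e m m′) 2≤∣j-k∣))
      (inQ j≤n ∷ inQ k≤n ∷ inQ j≤n ∷ inQ k≤n ∷ [])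
  kills-commute h img {k = k} (inside m refl) (next refl) j≤n _ 2≤∣j-k∣
    rewrite upperρ-+ (suc k) h m
          | upperρ-next k h =
    image-commutes img m (2≤∣1+k+m-k∣⇒1≤m k m 2≤∣j-k∣) (inQ j≤n)
  kills-commute h _ (inside m refl) (far 2+k≤e) j≤n _ _ rewrite upperρ-+ e h m | upperρ-far h 2+k≤e =
    xx~[] m (inQ j≤n)
  kills-commute h img {j} (next refl) (inside m refl) _ k≤n 2≤∣j-k∣
    rewrite upperρ-next j h
          | upperρ-+ (suc j) h m =
    image-commutes′ img m (2≤∣1+k+m-k∣⇒1≤m j m (subst (2 ≤_) (∣-∣-comm j (suc j + m)) 2≤∣j-k∣)) (inQ k≤n)
  kills-commute h _ {j} (next refl) (next refl) _ _ 2≤∣j-k∣ = ⊥-elim (∣n-n∣≱2 j 2≤∣j-k∣)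
  kills-commute h img {j} (next refl) (far 2+k≤e) _ _ _ rewrite upperρ-next j h | upperρ-far h 2+k≤e =
    image-involution img
  kills-commute h _ (far 2+j≤e) (inside m refl) _ k≤n _ rewrite upperρ-far h 2+j≤e | upperρ-+ e h m =
    xx~[] m (inQ k≤n)
  kills-commute h img {k = k} (far 2+j≤e) (next refl) _ _ _ rewrite upperρ-far h 2+j≤e | upperρ-next k h =
    image-involution img
  kills-commute h _ (far 2+j≤e) (far 2+k≤e) _ _ _ =
    kills-erased h _ (upperρ-far h 2+j≤e ∷ upperρ-far h 2+k≤e ∷ upperρ-far h 2+j≤e ∷ upperρ-far h 2+k≤e ∷ [])

  kills-braid : ∀ h → Image h → ∀ {j} → UpperWindow e j → ∀ q → entry ps (suc j) ≡ just q →
                Killed h (pow (j ∷ suc j ∷ []) q)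
  kills-braid h _ (inside m refl) q eq
    rewrite concatMap-pow (upperρ e h) (e + m ∷ suc (e + m) ∷ []) q | upperρ-+ e h m | upperρ-1+ e h m =
    relator~[] _ (braid m q (entry-qs m eq)) (All-pow q (<⇒≤ m<∣qs∣ ∷ m<∣qs∣ ∷ []))
    where m<∣qs∣ = entry⇒≤length qs m (entry-qs m eq)
  kills-braid _ (odd _ _ _) {j} (next₀ refl) q eq
    rewrite concatMap-pow (upperρ (suc j) (0 ∷ [])) (j ∷ suc j ∷ []) q
          | upperρ-next j (0 ∷ []) | upperρ-e (suc j) (0 ∷ []) =
    pow~[] _ q (xx~[] 0 z≤n)
  kills-braid _ (even 2∣) {j} (next₀ refl) q eq
    rewrite concatMap-pow (upperρ (suc j) []) (j ∷ suc j ∷ []) q | upperρ-next j [] | upperρ-e (suc j) [] =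
    even-pow~[] 0 q z≤n (2∣ q eq)
  kills-braid _ (odd a ea 2∤a) {j} (next₁ refl) q eq
    rewrite concatMap-pow (upperρ (2 + j) (0 ∷ [])) (j ∷ suc j ∷ []) q
          | upperρ-far (0 ∷ []) {j} ≤-refl | upperρ-next (suc j) (0 ∷ []) =
    even-pow~[] 0 q z≤n (proj₁ (leftNb (suc j) a q ea 2∤a eq))
  kills-braid _ (even _) {j} (next₁ refl) q eq =
    kills-erased [] _ (All-pow q (upperρ-far [] {j} ≤-refl ∷ upperρ-next (suc j) [] ∷ []))
  kills-braid h _ {j} (next₂ refl) q eq =
    kills-erased h _ (All-pow q (upperρ-far h (n≤1+n (2 + j)) ∷ upperρ-far h {suc j} ≤-refl ∷ []))
  kills-braid h _ (far 4+j≤e) q eq =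
    kills-erased h _ (All-pow q (upperρ-far h (m+n≤o⇒n≤o 2 4+j≤e) ∷ upperρ-far h (m+n≤o⇒n≤o 1 4+j≤e) ∷ []))

  2+m∈Q : ∀ m {b} → entry ps (suc (suc (e + m))) ≡ just b → 2 + m ≤ length qs
  2+m∈Q m eb = entry⇒≤length qs (suc m) (entry-qs₂ m eb)

  kills-rEE : ∀ h → Image h → ∀ {j} → UpperWindow e j → ∀ a b →
              entry ps (suc j) ≡ just a → entry ps (suc (suc j)) ≡ just b → 2 ∣ a → 2 ∣ b →
              Killed h (pow (j ∷ suc j ∷ suc (suc j) ∷ suc j ∷ []) 2)
  kills-rEE h _ (inside m refl) a b ea eb 2∣a 2∣b rewrite upperρ-+ e h m | upperρ-1+ e h m | upperρ-2+ e h m =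
    relator~[] _ (rEE m a b (entry-qs m ea) (entry-qs₂ m eb) 2∣a 2∣b) (All-pow 2 (x₀ ∷ x₁ ∷ x₂ ∷ x₁ ∷ []))
    where x₂ = 2+m∈Q m eb ; x₁ = <⇒≤ x₂ ; x₀ = <⇒≤ x₁
  kills-rEE _ (odd _ e′ 2∤) (next₀ refl) a b ea eb 2∣a 2∣b = ⊥-elim (parity-clash e′ ea 2∤ 2∣a)
  kills-rEE _ (even _) {j} (next₀ refl) a b ea eb 2∣a 2∣b
    rewrite upperρ-next j [] | upperρ-e (suc j) [] | upperρ-1+e (suc j) [] =
    ~-trans (cancel (0 ∷ 1 ∷ []) 0 z≤n) (~-trans (cancel (0 ∷ []) 1 1∈Q) (xx~[] 0 z≤n))
  kills-rEE _ (odd _ e′ 2∤) (next₁ refl) a b ea eb 2∣a 2∣b = ⊥-elim (parity-clash e′ eb 2∤ 2∣b)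
  kills-rEE _ (even _) {j} (next₁ refl) a b ea eb 2∣a 2∣b
    rewrite upperρ-far [] {j} ≤-refl | upperρ-next (suc j) [] | upperρ-e (2 + j) [] = xx~[] 0 z≤n
  kills-rEE h img {j} (next₂ refl) a b ea eb 2∣a 2∣b
    rewrite upperρ-far h (n≤1+n (2 + j))
          | upperρ-far h {suc j} ≤-refl
          | upperρ-next (2 + j) h = image-involution img
  kills-rEE h _ (far p) a b ea eb 2∣a 2∣b =
    kills-erased h _ (All-pow 2 (ρ₀ ∷ ρ₁ ∷ upperρ-far h p ∷ ρ₁ ∷ []))
    where ρ₀ = upperρ-far h (m+n≤o⇒n≤o 2 p) ; ρ₁ = upperρ-far h (m+n≤o⇒n≤o 1 p)

  kills-rOE : ∀ h → Image h → ∀ {j} → UpperWindow e j → ∀ a b →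
              entry ps (suc j) ≡ just a → entry ps (suc (suc j)) ≡ just b → ¬ 2 ∣ a → 2 ∣ b →
              Killed h (pow (j ∷ suc j ∷ suc (suc j) ∷ suc j ∷ suc (suc j) ∷ []) 2)
  kills-rOE h _ (inside m refl) a b ea eb 2∤a 2∣b rewrite upperρ-+ e h m | upperρ-1+ e h m | upperρ-2+ e h m =
    relator~[] _ (rOE m a b (entry-qs m ea) (entry-qs₂ m eb) 2∤a 2∣b) (All-pow 2 (x₀ ∷ x₁ ∷ x₂ ∷ x₁ ∷ x₂ ∷ []))
    where x₂ = 2+m∈Q m eb ; x₁ = <⇒≤ x₂ ; x₀ = <⇒≤ x₁
  kills-rOE _ (odd _ _ _) {j} (next₀ refl) a b ea eb 2∤a 2∣b
    rewrite upperρ-next j (0 ∷ []) | upperρ-e (suc j) (0 ∷ []) | upperρ-1+e (suc j) (0 ∷ []) =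
    ~-trans (cancel [] 0 z≤n) (~-trans (cancel (1 ∷ 0 ∷ 1 ∷ []) 0 z≤n) (~-trans (cancel (1 ∷ 0 ∷ []) 1 1∈Q)
      (~-trans (cancel (1 ∷ []) 0 z≤n) (xx~[] 1 1∈Q))))
  kills-rOE _ (even 2∣) (next₀ refl) a b ea eb 2∤a 2∣b = ⊥-elim (2∤a (2∣ a ea))
  kills-rOE _ (odd _ e′ 2∤) (next₁ refl) a b ea eb 2∤a 2∣b = ⊥-elim (parity-clash e′ eb 2∤ 2∣b)
  kills-rOE _ (even _) {j} (next₁ refl) a b ea eb 2∤a 2∣b
    rewrite upperρ-far [] {j} ≤-refl | upperρ-next (suc j) [] | upperρ-e (2 + j) [] =
    ~-trans (cancel [] 0 z≤n) (xx~[] 0 z≤n)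
  kills-rOE _ (odd _ _ _) {j} (next₂ refl) a b ea eb 2∤a 2∣b
    rewrite upperρ-far (0 ∷ []) (n≤1+n (2 + j))
          | upperρ-far (0 ∷ []) {suc j} ≤-refl
          | upperρ-next (2 + j) (0 ∷ []) =
    ~-trans (cancel [] 0 z≤n) (xx~[] 0 z≤n)
  kills-rOE _ (even _) {j} (next₂ refl) a b ea eb 2∤a 2∣b =
    kills-erased [] (pow (j ∷ suc j ∷ 2 + j ∷ suc j ∷ 2 + j ∷ []) 2)
      (All-pow 2 (ρ₀ ∷ ρ₁ ∷ upperρ-next (2 + j) [] ∷ ρ₁ ∷ upperρ-next (2 + j) [] ∷ []))
    where ρ₀ = upperρ-far [] (n≤1+n (2 + j)) ; ρ₁ = upperρ-far [] {suc j} ≤-refl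
  kills-rOE h _ (far p) a b ea eb 2∤a 2∣b =
    kills-erased h _ (All-pow 2 (ρ₀ ∷ ρ₁ ∷ upperρ-far h p ∷ ρ₁ ∷ upperρ-far h p ∷ []))
    where ρ₀ = upperρ-far h (m+n≤o⇒n≤o 2 p) ; ρ₁ = upperρ-far h (m+n≤o⇒n≤o 1 p)

  kills-rEO : ∀ h → Image h → ∀ {j} → UpperWindow e j → ∀ a b →
              entry ps (suc j) ≡ just a → entry ps (suc (suc j)) ≡ just b → 2 ∣ a → ¬ 2 ∣ b →
              Killed h (pow (suc (suc j) ∷ suc j ∷ j ∷ suc j ∷ j ∷ []) 2)
  kills-rEO h _ (inside m refl) a b ea eb 2∣a 2∤b rewrite upperρ-+ e h m | upperρ-1+ e h m | upperρ-2+ e h m =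
    relator~[] _ (rEO m a b (entry-qs m ea) (entry-qs₂ m eb) 2∣a 2∤b) (All-pow 2 (x₂ ∷ x₁ ∷ x₀ ∷ x₁ ∷ x₀ ∷ []))
    where x₂ = 2+m∈Q m eb ; x₁ = <⇒≤ x₂ ; x₀ = <⇒≤ x₁
  kills-rEO _ (odd _ e′ 2∤) (next₀ refl) a b ea eb 2∣a 2∤b = ⊥-elim (parity-clash e′ ea 2∤ 2∣a)
  kills-rEO _ (even _) {j} (next₀ refl) a b ea eb 2∣a 2∤b
    rewrite upperρ-next j [] | upperρ-e (suc j) [] | upperρ-1+e (suc j) [] =
    ~-trans (cancel (1 ∷ []) 0 z≤n) (~-trans (cancel [] 1 1∈Q) (xx~[] 0 z≤n))
  kills-rEO _ (odd _ _ _) {j} (next₁ refl) a b ea eb 2∣a 2∤b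
    rewrite upperρ-far (0 ∷ []) {j} ≤-refl | upperρ-next (suc j) (0 ∷ []) | upperρ-e (2 + j) (0 ∷ []) =
    ~-trans (cancel [] 0 z≤n) (~-trans (cancel [] 0 z≤n) (xx~[] 0 z≤n))
  kills-rEO _ (even 2∣) (next₁ refl) a b ea eb 2∣a 2∤b = ⊥-elim (2∤b (2∣ b eb))
  kills-rEO h img {j} (next₂ refl) a b ea eb 2∣a 2∤b
    rewrite upperρ-far h (n≤1+n (2 + j))
          | upperρ-far h {suc j} ≤-refl
          | upperρ-next (2 + j) h = image-involution img
  kills-rEO h _ (far p) a b ea eb 2∣a 2∤b =
    kills-erased h _ (All-pow 2 (upperρ-far h p ∷ ρ₁ ∷ ρ₀ ∷ ρ₁ ∷ ρ₀ ∷ []))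
    where ρ₀ = upperρ-far h (m+n≤o⇒n≤o 2 p) ; ρ₁ = upperρ-far h (m+n≤o⇒n≤o 1 p)

  kills : ∀ h → Image h → ∀ R → Relator ps R → All (_≤ length ps) R → Killed h R
  kills h img _ (invol j) (j≤n ∷ _) = kills-invol h img (upperLetter e j) j≤n
  kills h img _ (braid j q eq) _ = kills-braid h img (upperWindow e j) q eq
  kills h img _ (commute j k 2≤∣j-k∣) (j≤n ∷ k≤n ∷ _) =
    kills-commute h img (upperLetter e j) (upperLetter e k) j≤n k≤n 2≤∣j-k∣
  kills h img _ (rEE j a b ea eb 2∣a 2∣b) _ = kills-rEE h img (upperWindow e j) a b ea eb 2∣a 2∣b
  kills h img _ (rOE j a b ea eb 2∤a 2∣b) _ = kills-rOE h img (upperWindow e j) a b ea eb 2∤a 2∣b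
  kills h img _ (rEO j a b ea eb 2∣a 2∤b) _ = kills-rEO h img (upperWindow e j) a b ea eb 2∣a 2∤b

  iso : IsoHigh ps (suc e)
  iso with neighbourImage (entry ps e) 0
  ... | h , img = Retraction.iso ps qs e (e ≤_) (upperρ e h)
    (≤-reflexive (trans (cong (e +_) (length-drop e ps)) (m+[n∸m]≡n (<⇒≤ e<n))))
    (λ m _ → trans (sym (entry-drop e ps m)))
    (λ m _ → upperρ-+ e h m)
    (λ j j≤n e≤j → j ∸ e , sym (m+[n∸m]≡n e≤j) , inQ (subst (_≤ length ps) (sym (m+[n∸m]≡n e≤j)) j≤n))
    (λ m _ → m≤m+n e m)
    (kills h img)

lemma4p9 : (ps : List ℕ) → Admissible ps → (i : ℕ) → 1 ≤ i → i ≤ length ps →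
           entry ps i ≡ just 2 → IsoLow ps i × IsoHigh ps i
lemma4p9 ps adm (suc i₀) _ i≤n p≡2 = Lower.iso ps adm i₀ p≡2 i≤n , Upper.iso ps adm i₀ p≡2 i≤n
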